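{- Let $d\ge2$ and let $A$ be a $d$-dimensional block permutation of order $4$ with parameters $(\mathcal{E},\lambda,s)$ that is equivalent to $\mathcal{M}_4^d$, and let $C$ be a filled subcube of $A$ (with respect to these parameters). Let $B$ be the $(0,1)$-matrix obtained from $A$ by changing one entry $a_\beta=0$ with $\beta\in C$ to $1$. Then $\operatorname{per}B>0$.
   Context: Matrices are arrays indexed by $\{0,1,2,3\}^d$. Two matrices are equivalent if one is obtained from the other by permuting coordinate positions and applying permutations of $\{0,1,2,3\}$ to individual coordinates. $\mathcal{M}_4^d$ is the $(0,1)$-matrix with entry $1$ at $\alpha$ iff $\alpha_1+\dots+\alpha_d\equiv0\pmod4$. A diagonal is a set of $4$ indices pairwise differing in every coordinate; $\operatorname{per}B=\sum_D\prod_{\alpha\in D}b_\alpha$. Define $p_1,p_2,p_3,\mu_1,\mu_2,\mu_3:\{0,1,2,3\}\to\{0,1\}$: $p_1$: $0,1\mapsto0$, $2,3\mapsto1$; $p_2$: $0,2\mapsto0$, $1,3\mapsto1$; $p_3$: $0,3\mapsto0$, $1,2\mapsto1$; $\mu_1$: $0,2\mapsto0$, $1,3\mapsto1$; $\mu_2$: $0,1\mapsto0$, $2,3\mapsto1$; $\mu_3$: $0,2\mapsto0$, $1,3\mapsto1$. $Q_s^d=\{y\in\{0,1\}^d:\sum y_i\equiv s \pmod 2\}$. For $\mathcal{E}=(\varepsilon_1,\dots,\varepsilon_d)\in\{1,2,3\}^d$, $s\in\{0,1\}$, $\lambda:Q_s^d\to\{0,1\}$, a $(0,1)$-matrix $A$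 is a block permutation with parameters $(\mathcal{E},\lambda,s)$ if $a_\alpha=1$ exactly when $\bigoplus_i p_{\varepsilon_i}(\alpha_i)=s$ and $\bigoplus_i\mu_{\varepsilon_i}(\alpha_i)\oplus\lambda(p_{\varepsilon_1}(\alpha_1),\dots,p_{\varepsilon_d}(\alpha_d))=0$. The subcubes for $\mathcal{E}$ are $C_y=\{\alpha: p_{\varepsilon_i}(\alpha_i)=y_i\ \forall i\}$, $y\in\{0,1\}^d$; $C_y$ is filled if $y\in Q_s^d$ (then $A$ restricted to $C_y$ is a permutation of order $2$), and empty otherwise. -}

module Defs where

open import Data.Bool using (Bool; true; false; _∧_; _∨_; not; _xor_; if_then_else_)
open import Data.Nat using (ℕ; zero; suc; _+_; _*_; _%_; _/_; _≡ᵇ_)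
open import Data.Fin using (Fin; toℕ; _≟_)
open import Data.Fin.Permutation using (Permutation′; _⟨$⟩ʳ_)
open import Data.List using (List; []; _∷_; map; concatMap; filter; allFin)
open import Data.Nat.ListAction using (sum)
open import Data.Vec.Functional using () renaming (_∷_ to _∷ᶠ_)
open import Relation.Binary.PropositionalEquality using (_≡_)
open import Relation.Nullary.Decidable using (⌊_⌋)
open import Data.Product using (Σ; _×_; ∃)

Idx : ℕ → Set
Idx d = Fin d → Fin 4

Matrix01 : ℕ → Set
Matrix01 d = Idx d → Bool

sumF : ∀ {d} → (Fin d → ℕ) → ℕ
sumF {zero} f = 0
sumF {suc d} f = f Data.Fin.zero + sumF (λ i → f (Data.Fin.suc i))

xorF : ∀ {d} → (Fin d → Bool) → Bool
xorF {zero} f = false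
xorF {suc d} f = f Data.Fin.zero xor xorF (λ i → f (Data.Fin.suc i))

andF : ∀ {d} → (Fin d → Bool) → Bool
andF {zero} f = true
andF {suc d} f = f Data.Fin.zero ∧ andF (λ i → f (Data.Fin.suc i))

toNat : Bool → ℕ
toNat true = 1
toNat false = 0

M4 : (d : ℕ) → Matrix01 d
M4 d α = (sumF (λ i → toℕ (α i)) % 4) ≡ᵇ 0

Equivalent : ∀ {d} → Matrix01 d → Matrix01 d → Set
Equivalent {d} A M =
  Σ (Permutation′ d) λ σ → Σ (Fin d → Permutation′ 4) λ τ →
    ∀ (α : Idx d) → A α ≡ M (λ i → τ i ⟨$⟩ʳ α (σ ⟨$⟩ʳ i))

-- An ordered diagonal (D_0,..,D_3) with D_j, D_k differing in every
-- coordinate (j ≠ k) is exactly a family of injective maps π_i : Fin 4 → Fin 4,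
-- D_k = (π_1 k, ..., π_d k).  Each (unordered) diagonal arises from exactly 4! = 24
-- ordered ones (for d ≥ 1), so per B = (Σ_ordered ∏ b) / 24.
allFuns4 : List (Fin 4 → Fin 4)
allFuns4 =
  concatMap (λ a → concatMap (λ b → concatMap (λ c → map (λ e → a ∷ᶠ b ∷ᶠ c ∷ᶠ e ∷ᶠ (λ ()))
    (allFin 4)) (allFin 4)) (allFin 4)) (allFin 4)

injective4 : (Fin 4 → Fin 4) → Bool
injective4 f = andF {4} (λ j → andF {4} (λ k → ⌊ j ≟ k ⌋ ∨ not ⌊ f j ≟ f k ⌋))

perms4 : List (Fin 4 → Fin 4)
perms4 = filter (λ f → injective4 f ≟B true) allFuns4
  where
  open import Data.Bool.Properties using () renaming (_≟_ to _≟B_)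

orderedDiagonals : (d : ℕ) → List (Fin d → Fin 4 → Fin 4)
orderedDiagonals zero = (λ ()) ∷ []
orderedDiagonals (suc d) = concatMap (λ π → map (λ r → π ∷ᶠ r) (orderedDiagonals d)) perms4

prod4 : (Fin 4 → ℕ) → ℕ
prod4 f = f Data.Fin.zero * f (Data.Fin.suc Data.Fin.zero)
        * f (Data.Fin.suc (Data.Fin.suc Data.Fin.zero))
        * f (Data.Fin.suc (Data.Fin.suc (Data.Fin.suc Data.Fin.zero)))

per : ∀ {d} → Matrix01 d → ℕ
per {d} B = sum (map (λ π → prod4 (λ k → toNat (B (λ i → π i k)))) (orderedDiagonals d)) / 24

data Eps : Set where
  e1 e2 e3 : Eps

p : Eps → Fin 4 → Bool
p e1 x = ⌊ toℕ x Data.Nat.≟ 2 ⌋ ∨ ⌊ toℕ x Data.Nat.≟ 3 ⌋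
p e2 x = ⌊ toℕ x % 2 Data.Nat.≟ 1 ⌋
p e3 x = ⌊ toℕ x Data.Nat.≟ 1 ⌋ ∨ ⌊ toℕ x Data.Nat.≟ 2 ⌋

μ : Eps → Fin 4 → Bool
μ e1 x = ⌊ toℕ x % 2 Data.Nat.≟ 1 ⌋
μ e2 x = ⌊ toℕ x Data.Nat.≟ 2 ⌋ ∨ ⌊ toℕ x Data.Nat.≟ 3 ⌋
μ e3 x = ⌊ toℕ x % 2 Data.Nat.≟ 1 ⌋

-- λ is given as a function on all of {0,1}^d; only its values on Q_s^d matter
-- (it is only evaluated at points in Q_s^d, thanks to the first conjunct).
pvec : ∀ {d} → (Fin d → Eps) → Idx d → (Fin d → Bool)
pvec E α i = p (E i) (α i)

BlockPermEntry : ∀ {d} → (Fin d → Eps) → ((Fin d → Bool) → Bool) → Bool → Idx d → Bool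
BlockPermEntry E lam s α =
  ⌊ xorF (pvec E α) Data.Bool.Properties.≟ s ⌋ ∧
  not (xorF (λ i → μ (E i) (α i)) xor lam (pvec E α))
  where import Data.Bool.Properties

IsBlockPerm : ∀ {d} → Matrix01 d → (Fin d → Eps) → ((Fin d → Bool) → Bool) → Bool → Set
IsBlockPerm A E lam s = ∀ α → A α ≡ BlockPermEntry E lam s α

InSubcube : ∀ {d} → (Fin d → Eps) → (Fin d → Bool) → Idx d → Set
InSubcube E y α = ∀ i → p (E i) (α i) ≡ y i

Filled : ∀ {d} → Bool → (Fin d → Bool) → Set
Filled s y = xorF y ≡ s

idxEq : ∀ {d} → Idx d → Idx d → Bool
idxEq α β = andF (λ i → ⌊ α i ≟ β i ⌋)

setOne : ∀ {d} → Matrix01 d → Idx d → Matrix01 d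
setOne A β α = if idxEq α β then true else A α

-- In the coordinates of 𝓜₄ᵈ the ones of A are the points whose coordinates sum to 0 in ℤ/4, and,
-- A being a block permutation, they all lie in filled subcubes. For d even the rows
-- (k, −k, k, −k, …), k ∈ ℤ/4, already form a diagonal of ones. For d odd let b be the changed
-- entry, which lies in a filled subcube, and r its coordinate sum. Shifting one coordinate of b
-- by −r gives a one, in a filled subcube differing from b's in that coordinate only, so the
-- p-value of that coordinate is the same at b_j and b_j − r. Shifting two coordinates by −r and
-- then a third, j₀, by +r, the same holds for b_{j₀} + r. As each p_ε is two-to-one, two of
-- b_{j₀}, b_{j₀} − r, b_{j₀} + r coincide: 2r = 0, so r = 2. Then b together with the rows
-- b + (k, ρk, ρ²k, k, −k, …), k ≠ 0, where ρ is the 3-cycle of {1, 2, 3}, is a diagonal of B,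
-- because k + ρk + ρ²k = 1 + 2 + 3 = 2.
module Submission where

open import Defs
open import Algebra.Bundles using (CommutativeRing)
open import Data.Bool using (Bool; true; false; _∧_; _∨_; not; _xor_; if_then_else_)
open import Data.Bool.Properties using (xor-same; xor-identityʳ; xor-∧-commutativeRing)
  renaming (_≟_ to _≟ᴮ_)
open import Data.Fin using (Fin; zero; suc; toℕ; _≟_)
open import Data.Fin.Patterns using (0F; 1F; 2F; 3F)
open import Data.Fin.Permutation
  using (Permutation′; permutation; _⟨$⟩ʳ_; _⟨$⟩ˡ_; inverseˡ; inverseʳ; id; flip; _∘ₚ_)
open import Data.Fin.Properties using (all?; toℕ-fromℕ<; suc-injective)
open import Data.List using (List; []; _∷_; _++_; map; concatMap; length; allFin)
open import Data.List.Membership.Propositional using (_∈_)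
open import Data.List.Membership.Propositional.Properties
  using (∈-map⁺; ∈-concat⁺′; ∈-filter⁺; ∈-filter⁻; ∈-allFin)
open import Data.List.Properties using (map-++)
open import Data.List.Relation.Unary.Any using (here; there)
open import Data.Nat using (ℕ; zero; suc; _+_; _∸_; _%_; _≡ᵇ_; _≤_; _<_; z≤n; s≤s; parity)
open import Data.Parity.Base using (0ℙ)
open import Data.Nat.DivMod using (_mod_; %-distribˡ-+; m%n%n≡m%n; m≥n⇒m/n>0)
open import Data.Nat.ListAction using (sum)
open import Data.Nat.ListAction.Properties using (sum-++)
open import Data.Nat.Properties using (≤-trans; ≤-reflexive; +-mono-≤; m≤m+n; m≤n+m; module ≤-Reasoning)
open import Data.Product using (∃-syntax; _×_; _,_; proj₂)
open import Data.Sum using (_⊎_; inj₁; inj₂; [_,_]′) renaming (map to ⊎-map)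
open import Data.Vec.Functional using (updateAt) renaming (_∷_ to _∷ᶠ_)
open import Data.Vec.Functional.Properties using (updateAt-updates; updateAt-minimal)
open import Function using (_∘_)
open import Function.Construct.Composition using () renaming (injective to ∘-injective)
open import Function.Definitions using (Injective)
open import Relation.Binary.PropositionalEquality
open import Relation.Nullary using (Dec; yes; no; contradiction)
open import Relation.Nullary.Decidable using (⌊_⌋; from-yes; ¬?; _→-dec_; _⊎-dec_)

open import Algebra.Properties.CommutativeSemigroup
  (CommutativeRing.+-commutativeSemigroup xor-∧-commutativeRing) using (interchange)

-- ℤ/4 on Fin 4

infixl 6 _⊕_
infix 8 ⊖_

_⊕_ : Fin 4 → Fin 4 → Fin 4
x ⊕ y = (toℕ x + toℕ y) mod 4

⊖_ : Fin 4 → Fin 4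
⊖ x = (4 ∸ toℕ x) mod 4

toℕ-⊕ : ∀ x y → toℕ (x ⊕ y) ≡ (toℕ x + toℕ y) % 4
toℕ-⊕ x y = toℕ-fromℕ< _

⊕-assoc : ∀ x y z → (x ⊕ y) ⊕ z ≡ x ⊕ (y ⊕ z)
⊕-assoc = from-yes (all? λ x → all? λ y → all? λ z → (x ⊕ y) ⊕ z ≟ x ⊕ (y ⊕ z))

⊕-rightComm : ∀ x y z → (x ⊕ y) ⊕ z ≡ (x ⊕ z) ⊕ y
⊕-rightComm = from-yes (all? λ x → all? λ y → all? λ z → (x ⊕ y) ⊕ z ≟ (x ⊕ z) ⊕ y)

⊕-interchange : ∀ w x y z → (w ⊕ x) ⊕ (y ⊕ z) ≡ (w ⊕ y) ⊕ (x ⊕ z)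
⊕-interchange = from-yes (all? λ w → all? λ x → all? λ y → all? λ z →
  (w ⊕ x) ⊕ (y ⊕ z) ≟ (w ⊕ y) ⊕ (x ⊕ z))

⊕-identityˡ : ∀ x → 0F ⊕ x ≡ x
⊕-identityˡ = from-yes (all? λ x → 0F ⊕ x ≟ x)

⊕-identityʳ : ∀ x → x ⊕ 0F ≡ x
⊕-identityʳ = from-yes (all? λ x → x ⊕ 0F ≟ x)

⊕-inverseˡ : ∀ x → ⊖ x ⊕ x ≡ 0F
⊕-inverseˡ = from-yes (all? λ x → ⊖ x ⊕ x ≟ 0F)

⊕-inverseʳ : ∀ x → x ⊕ ⊖ x ≡ 0F
⊕-inverseʳ = from-yes (all? λ x → x ⊕ ⊖ x ≟ 0F)

⊖-involutive : ∀ x → ⊖ ⊖ x ≡ x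
⊖-involutive = from-yes (all? λ x → ⊖ ⊖ x ≟ x)

x⊕y⊖y≡x : ∀ x y → x ⊕ y ⊕ ⊖ y ≡ x
x⊕y⊖y≡x x y = trans (⊕-assoc x y (⊖ y)) (trans (cong (x ⊕_) (⊕-inverseʳ y)) (⊕-identityʳ x))

x⊖y⊕y≡x : ∀ x y → x ⊕ ⊖ y ⊕ y ≡ x
x⊖y⊕y≡x x y = trans (⊕-assoc x (⊖ y) y) (trans (cong (x ⊕_) (⊕-inverseˡ y)) (⊕-identityʳ x))

translates-coincide : ∀ x r → x ≡ x ⊕ ⊖ r ⊎ x ≡ x ⊕ r ⊎ x ⊕ ⊖ r ≡ x ⊕ r → r ⊕ r ≡ 0F
translates-coincide = from-yes (all? λ x → all? λ r →
  (x ≟ x ⊕ ⊖ r ⊎-dec x ≟ x ⊕ r ⊎-dec x ⊕ ⊖ r ≟ x ⊕ r) →-dec (r ⊕ r ≟ 0F))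

r⊕r≡0⇒r≡2 : ∀ r → r ≢ 0F → r ⊕ r ≡ 0F → r ≡ 2F
r⊕r≡0⇒r≡2 = from-yes (all? λ r → ¬? (r ≟ 0F) →-dec (r ⊕ r ≟ 0F →-dec r ≟ 2F))

rotate : Fin 4 → Fin 4
rotate 0F = 0F
rotate 1F = 2F
rotate 2F = 3F
rotate 3F = 1F

rotate-orbit-sum : ∀ k → k ≢ 0F → k ⊕ (rotate k ⊕ rotate (rotate k)) ≡ 2F
rotate-orbit-sum = from-yes (all? λ k → ¬? (k ≟ 0F) →-dec (k ⊕ (rotate k ⊕ rotate (rotate k)) ≟ 2F))

rotate³ : ∀ k → rotate (rotate (rotate k)) ≡ k
rotate³ = from-yes (all? λ k → rotate (rotate (rotate k)) ≟ k)

negation : Permutation′ 4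
negation = permutation ⊖_ ⊖_ ⊖-involutive ⊖-involutive

translation : Fin 4 → Permutation′ 4
translation b = permutation (_⊕ b) (_⊕ ⊖ b) (λ x → x⊖y⊕y≡x x b) (λ x → x⊕y⊖y≡x x b)

rotation : Permutation′ 4
rotation = permutation rotate (rotate ∘ rotate) rotate³ rotate³

-- Coordinate sums, 𝓜₄ᵈ and parities

sum₄ : ∀ {d} → (Fin d → Fin 4) → Fin 4
sum₄ {zero} γ = 0F
sum₄ {suc d} γ = γ zero ⊕ sum₄ (λ i → γ (suc i))

sum₄-⊕ : ∀ {d} (γ δ : Fin d → Fin 4) → sum₄ (λ j → γ j ⊕ δ j) ≡ sum₄ γ ⊕ sum₄ δ
sum₄-⊕ {zero} γ δ = refl
sum₄-⊕ {suc d} γ δ = trans (cong (γ zero ⊕ δ zero ⊕_) (sum₄-⊕ (γ ∘ suc) (δ ∘ suc)))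
                           (⊕-interchange (γ zero) (δ zero) _ _)

sum₄-shift : ∀ {d} (γ : Fin d → Fin 4) j c → sum₄ (updateAt γ j (_⊕ c)) ≡ sum₄ γ ⊕ c
sum₄-shift {suc d} γ zero c = ⊕-rightComm (γ zero) c _
sum₄-shift {suc d} γ (suc j) c = trans (cong (γ zero ⊕_) (sum₄-shift (γ ∘ suc) j c))
                                       (sym (⊕-assoc (γ zero) _ c))

toℕ-sum₄ : ∀ {d} (γ : Fin d → Fin 4) → toℕ (sum₄ γ) ≡ sumF (toℕ ∘ γ) % 4
toℕ-sum₄ {zero} γ = refl
toℕ-sum₄ {suc d} γ = begin
  toℕ (γ zero ⊕ sum₄ (γ ∘ suc))      ≡⟨ toℕ-⊕ (γ zero) _ ⟩
  (x + toℕ (sum₄ (γ ∘ suc))) % 4     ≡⟨ cong (λ t → (x + t) % 4) (toℕ-sum₄ (γ ∘ suc)) ⟩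
  (x + rest % 4) % 4                 ≡⟨ %-distribˡ-+ x (rest % 4) 4 ⟩
  (x % 4 + rest % 4 % 4) % 4         ≡⟨ cong (λ t → (x % 4 + t) % 4) (m%n%n≡m%n rest 4) ⟩
  (x % 4 + rest % 4) % 4             ≡⟨ %-distribˡ-+ x rest 4 ⟨
  (x + rest) % 4                     ∎
  where
  open ≡-Reasoning
  x = toℕ (γ zero)
  rest = sumF (toℕ ∘ γ ∘ suc)

sumF-cong : ∀ {d} {f g : Fin d → ℕ} → f ≗ g → sumF f ≡ sumF g
sumF-cong {zero} f≗g = refl
sumF-cong {suc d} f≗g = cong₂ _+_ (f≗g zero) (sumF-cong (f≗g ∘ suc))

M4-cong : ∀ {d} {α α′ : Idx d} → α ≗ α′ → M4 d α ≡ M4 d α′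
M4-cong α≗α′ = cong (λ t → t % 4 ≡ᵇ 0) (sumF-cong (cong toℕ ∘ α≗α′))

sum₄≡0⇒M4 : ∀ {d} {γ : Idx d} → sum₄ γ ≡ 0F → M4 d γ ≡ true
sum₄≡0⇒M4 {γ = γ} Σγ≡0 = trans (cong (_≡ᵇ 0) (sym (toℕ-sum₄ γ))) (cong (λ t → toℕ t ≡ᵇ 0) Σγ≡0)

xorF-cong : ∀ {d} {f g : Fin d → Bool} → f ≗ g → xorF f ≡ xorF g
xorF-cong {zero} f≗g = refl
xorF-cong {suc d} f≗g = cong₂ _xor_ (f≗g zero) (xorF-cong (f≗g ∘ suc))

xorF-agree-except : ∀ {d} (f g : Fin d → Bool) i₀ → (∀ i → i ≢ i₀ → f i ≡ g i) →
                    xorF f xor xorF g ≡ f i₀ xor g i₀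
xorF-agree-except {suc d} f g zero agree = begin
  (f zero xor xorF (f ∘ suc)) xor (g zero xor xorF (g ∘ suc))
    ≡⟨ cong (λ t → (f zero xor t) xor (g zero xor xorF (g ∘ suc)))
            (xorF-cong λ i → agree (suc i) λ ()) ⟩
  (f zero xor xorF (g ∘ suc)) xor (g zero xor xorF (g ∘ suc))
    ≡⟨ interchange (f zero) _ (g zero) _ ⟩
  (f zero xor g zero) xor (xorF (g ∘ suc) xor xorF (g ∘ suc))
    ≡⟨ cong ((f zero xor g zero) xor_) (xor-same (xorF (g ∘ suc))) ⟩
  (f zero xor g zero) xor false
    ≡⟨ xor-identityʳ _ ⟩
  f zero xor g zero ∎
  where open ≡-Reasoning
xorF-agree-except {suc d} f g (suc i₀) agree = begin
  (f zero xor xorF (f ∘ suc)) xor (g zero xor xorF (g ∘ suc))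
    ≡⟨ cong (λ t → (f zero xor xorF (f ∘ suc)) xor (t xor xorF (g ∘ suc))) (sym (agree zero λ ())) ⟩
  (f zero xor xorF (f ∘ suc)) xor (f zero xor xorF (g ∘ suc))
    ≡⟨ interchange (f zero) _ (f zero) _ ⟩
  (f zero xor f zero) xor (xorF (f ∘ suc) xor xorF (g ∘ suc))
    ≡⟨ cong (_xor (xorF (f ∘ suc) xor xorF (g ∘ suc))) (xor-same (f zero)) ⟩
  xorF (f ∘ suc) xor xorF (g ∘ suc)
    ≡⟨ xorF-agree-except (f ∘ suc) (g ∘ suc) i₀ (λ i i≢i₀ → agree (suc i) (i≢i₀ ∘ suc-injective)) ⟩
  f (suc i₀) xor g (suc i₀) ∎
  where open ≡-Reasoning

xor≡false⇒≡ : ∀ x y → x xor y ≡ false → x ≡ y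
xor≡false⇒≡ false false _ = refl
xor≡false⇒≡ true  true  _ = refl
xor≡false⇒≡ false true  ()
xor≡false⇒≡ true  false ()

andF-cong : ∀ {d} {f g : Fin d → Bool} → f ≗ g → andF f ≡ andF g
andF-cong {zero} f≗g = refl
andF-cong {suc d} f≗g = cong₂ _∧_ (f≗g zero) (andF-cong (f≗g ∘ suc))

andF-true⁺ : ∀ {d} (f : Fin d → Bool) → (∀ i → f i ≡ true) → andF f ≡ true
andF-true⁺ {zero} f all-true = refl
andF-true⁺ {suc d} f all-true rewrite all-true zero = andF-true⁺ (f ∘ suc) (all-true ∘ suc)

andF-true⁻ : ∀ {d} (f : Fin d → Bool) → andF f ≡ true → ∀ i → f i ≡ true
andF-true⁻ {suc d} f conj i with f zero in f₀
andF-true⁻ {suc d} f conj zero    | true = f₀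
andF-true⁻ {suc d} f conj (suc i) | true = andF-true⁻ (f ∘ suc) conj i

-- Positive permanents

injective4⇒Injective : ∀ f → injective4 f ≡ true → Injective _≡_ _≡_ f
injective4⇒Injective f inj {j} {k} fj≡fk
  with j ≟ k | f j ≟ f k | andF-true⁻ (λ k → ⌊ j ≟ k ⌋ ∨ not ⌊ f j ≟ f k ⌋)
                           (andF-true⁻ (λ j → andF λ k → ⌊ j ≟ k ⌋ ∨ not ⌊ f j ≟ f k ⌋) inj j) k
... | yes j≡k | _        | _ = j≡k
... | no _    | yes _    | ()
... | no _    | no fj≢fk | _ = contradiction fj≡fk fj≢fk

Injective⇒injective4 : ∀ f → Injective _≡_ _≡_ f → injective4 f ≡ true
Injective⇒injective4 f inj = andF-true⁺ _ λ j → andF-true⁺ _ λ k → distinct-or-equal j k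
  where
  distinct-or-equal : ∀ j k → (⌊ j ≟ k ⌋ ∨ not ⌊ f j ≟ f k ⌋) ≡ true
  distinct-or-equal j k with j ≟ k | f j ≟ f k
  ... | yes _ | _        = refl
  ... | no _  | no _     = refl
  ... | no j≢k | yes fj≡fk = contradiction (inj fj≡fk) j≢k

-- expand f ≗ f, written in the form in which allFuns4 enumerates functions.
expand : (Fin 4 → Fin 4) → (Fin 4 → Fin 4)
expand f = f 0F ∷ᶠ f 1F ∷ᶠ f 2F ∷ᶠ f 3F ∷ᶠ λ ()

expand-≗ : ∀ f → expand f ≗ f
expand-≗ f 0F = refl
expand-≗ f 1F = refl
expand-≗ f 2F = refl
expand-≗ f 3F = refl

∈-concatMap : ∀ {A B : Set} (h : A → List B) {x : A} {xs : List A} {y : B} →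
              y ∈ h x → x ∈ xs → y ∈ concatMap h xs
∈-concatMap h y∈hx x∈xs = ∈-concat⁺′ y∈hx (∈-map⁺ h x∈xs)

expand∈allFuns4 : ∀ f → expand f ∈ allFuns4
expand∈allFuns4 f =
  ∈-concatMap (λ a → concatMap (λ b → concatMap (λ c → map (λ e → a ∷ᶠ b ∷ᶠ c ∷ᶠ e ∷ᶠ λ ())
                 (allFin 4)) (allFin 4)) (allFin 4))
    (∈-concatMap (λ b → concatMap (λ c → map (λ e → f 0F ∷ᶠ b ∷ᶠ c ∷ᶠ e ∷ᶠ λ ()) (allFin 4)) (allFin 4))
      (∈-concatMap (λ c → map (λ e → f 0F ∷ᶠ f 1F ∷ᶠ c ∷ᶠ e ∷ᶠ λ ()) (allFin 4))
        (∈-map⁺ (λ e → f 0F ∷ᶠ f 1F ∷ᶠ f 2F ∷ᶠ e ∷ᶠ λ ()) (∈-allFin (f 3F)))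
        (∈-allFin (f 2F)))
      (∈-allFin (f 1F)))
    (∈-allFin (f 0F))

expand∈perms4 : ∀ f → Injective _≡_ _≡_ f → expand f ∈ perms4
expand∈perms4 f inj = ∈-filter⁺ (λ g → injective4 g ≟ᴮ true) (expand∈allFuns4 f)
  (Injective⇒injective4 (expand f) λ {j} {k} e →
    inj (trans (sym (expand-≗ f j)) (trans e (expand-≗ f k))))

∈perms4⇒Injective : ∀ {f} → f ∈ perms4 → Injective _≡_ _≡_ f
∈perms4⇒Injective {f} f∈ =
  injective4⇒Injective f (proj₂ (∈-filter⁻ (λ g → injective4 g ≟ᴮ true) {xs = allFuns4} f∈))

∈-orderedDiagonals : ∀ d (π : Fin d → Fin 4 → Fin 4) → (∀ i → Injective _≡_ _≡_ (π i)) →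
                     ∃[ π′ ] π′ ∈ orderedDiagonals d × (∀ i → π′ i ≗ π i)
∈-orderedDiagonals zero π _ = _ , here refl , λ ()
∈-orderedDiagonals (suc d) π inj
  with π′ , π′∈ , π′≗π ← ∈-orderedDiagonals d (π ∘ suc) (inj ∘ suc) =
  expand (π zero) ∷ᶠ π′ ,
  ∈-concatMap (λ ρ → map (ρ ∷ᶠ_) (orderedDiagonals d))
    (∈-map⁺ (expand (π zero) ∷ᶠ_) π′∈) (expand∈perms4 (π zero) (inj zero)) ,
  λ { zero → expand-≗ (π zero) ; (suc i) → π′≗π i }

∈⇒≤sum : ∀ {A : Set} (g : A → ℕ) {x xs} → x ∈ xs → g x ≤ sum (map g xs)
∈⇒≤sum g (here refl) = m≤m+n _ _
∈⇒≤sum g {xs = y ∷ ys} (there x∈) = ≤-trans (∈⇒≤sum g x∈) (m≤n+m _ (g y))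

length≤sum : ∀ {A : Set} (g : A → ℕ) xs → (∀ {x} → x ∈ xs → 1 ≤ g x) → length xs ≤ sum (map g xs)
length≤sum g [] _ = z≤n
length≤sum g (x ∷ xs) pos = +-mono-≤ (pos (here refl)) (length≤sum g xs (pos ∘ there))

sum-map-concatMap : ∀ {A B : Set} (g : B → ℕ) (h : A → List B) xs →
                    sum (map g (concatMap h xs)) ≡ sum (map (λ x → sum (map g (h x))) xs)
sum-map-concatMap g h [] = refl
sum-map-concatMap g h (x ∷ xs) = begin
  sum (map g (h x ++ concatMap h xs))          ≡⟨ cong sum (map-++ g (h x) (concatMap h xs)) ⟩
  sum (map g (h x) ++ map g (concatMap h xs))  ≡⟨ sum-++ (map g (h x)) _ ⟩
  sum (map g (h x)) + sum (map g (concatMap h xs))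
    ≡⟨ cong (sum (map g (h x)) +_) (sum-map-concatMap g h xs) ⟩
  sum (map g (h x)) + sum (map (λ x → sum (map g (h x))) xs) ∎
  where open ≡-Reasoning

prod4-ones : (f : Fin 4 → Bool) → (∀ k → f k ≡ true) → prod4 (toNat ∘ f) ≡ 1
prod4-ones f ones rewrite ones 0F | ones 1F | ones 2F | ones 3F = refl

Congruent : ∀ {d} → Matrix01 d → Set
Congruent B = ∀ {α α′} → α ≗ α′ → B α ≡ B α′

permutation-injective : ∀ {n} (π : Permutation′ n) → Injective _≡_ _≡_ (π ⟨$⟩ʳ_)
permutation-injective π {x} {y} πx≡πy =
  trans (sym (inverseˡ π)) (trans (cong (π ⟨$⟩ˡ_) πx≡πy) (inverseˡ π))

-- Every reordering ρ of the four rows of a diagonal of ones is an ordered diagonal of ones with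
-- first coordinate ρ; these are 4! = 24 ordered diagonals, which is what per divides by.
0<per-of-diagonal : ∀ {d} (B : Matrix01 (suc d)) → Congruent B → (π : Fin (suc d) → Permutation′ 4) →
                    (∀ k → B (λ i → π i ⟨$⟩ʳ k) ≡ true) → 0 < per B
0<per-of-diagonal {d} B B-cong π rows = m≥n⇒m/n>0 (begin
  24                                                  ≡⟨⟩
  length perms4                                       ≤⟨ length≤sum _ perms4 reordered ⟩
  sum (map (sum ∘ map weight ∘ startingWith) perms4)  ≡⟨ sum-map-concatMap weight startingWith perms4 ⟨
  sum (map weight (orderedDiagonals (suc d)))         ∎)
  where
  open ≤-Reasoning

  weight : (Fin (suc d) → Fin 4 → Fin 4) → ℕ
  weight π′ = prod4 (λ k → toNat (B (λ i → π′ i k)))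

  startingWith : (Fin 4 → Fin 4) → List (Fin (suc d) → Fin 4 → Fin 4)
  startingWith ρ = map (ρ ∷ᶠ_) (orderedDiagonals d)

  reindexed : (Fin 4 → Fin 4) → Fin d → Fin 4 → Fin 4
  reindexed ρ i k = π (suc i) ⟨$⟩ʳ (π zero ⟨$⟩ˡ ρ k)

  reindexed-injective : ∀ {ρ} → ρ ∈ perms4 → ∀ i → Injective _≡_ _≡_ (reindexed ρ i)
  reindexed-injective ρ∈ i =
    ∘-injective _≡_ _≡_ _≡_ (∈perms4⇒Injective ρ∈)
      (∘-injective _≡_ _≡_ _≡_ (permutation-injective (flip (π zero)))
                               (permutation-injective (π (suc i))))

  reordered : ∀ {ρ} → ρ ∈ perms4 → 1 ≤ sum (map weight (startingWith ρ))
  reordered {ρ} ρ∈ with π′ , π′∈ , π′≗ ← ∈-orderedDiagonals d (reindexed ρ) (reindexed-injective ρ∈) =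
    ≤-trans (≤-reflexive (sym weight≡1)) (∈⇒≤sum weight (∈-map⁺ (ρ ∷ᶠ_) π′∈))
    where
    row≗ : ∀ k → (λ i → (ρ ∷ᶠ π′) i k) ≗ (λ i → π i ⟨$⟩ʳ (π zero ⟨$⟩ˡ ρ k))
    row≗ k zero = sym (inverseʳ (π zero))
    row≗ k (suc i) = π′≗ i k
    weight≡1 : weight (ρ ∷ᶠ π′) ≡ 1
    weight≡1 = prod4-ones _ λ k → trans (B-cong (row≗ k)) (rows (π zero ⟨$⟩ˡ ρ k))

setOne-congruent : ∀ {d} {A : Matrix01 d} → Congruent A → ∀ β → Congruent (setOne A β)
setOne-congruent A-cong β α≗α′ =
  cong₂ (λ hit a → if hit then true else a)
        (andF-cong λ i → cong (λ x → ⌊ x ≟ β i ⌋) (α≗α′ i)) (A-cong α≗α′)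

setOne-≥ : ∀ {d} (A : Matrix01 d) β {α} → A α ≡ true → setOne A β α ≡ true
setOne-≥ A β {α} Aα with idxEq α β
... | true  = refl
... | false = Aα

⌊≟⌋-true : ∀ {n} {x y : Fin n} → x ≡ y → ⌊ x ≟ y ⌋ ≡ true
⌊≟⌋-true {x = x} {y} x≡y with x ≟ y
... | yes _   = refl
... | no x≢y = contradiction x≡y x≢y

setOne-at : ∀ {d} (A : Matrix01 d) β {α} → α ≗ β → setOne A β α ≡ true
setOne-at A β {α} α≗β rewrite andF-true⁺ (λ i → ⌊ α i ≟ β i ⌋) (⌊≟⌋-true ∘ α≗β) = refl

-- Block permutations equivalent to 𝓜₄ᵈ

ones-in-filled-subcubes : ∀ {d} {A : Matrix01 d} {E lam s} → IsBlockPerm A E lam s →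
                          ∀ α → A α ≡ true → Filled s (pvec E α)
ones-in-filled-subcubes {E = E} {s = s} isB α Aα with xorF (pvec E α) ≟ᴮ s | isB α
... | yes filled | _   = filled
... | no _       | A≡0 = contradiction (trans (sym Aα) A≡0) λ ()

module Relabelling {d} (σ : Permutation′ d) (τ : Fin d → Permutation′ 4) where

  to : Idx d → Idx d
  to α j = τ j ⟨$⟩ʳ α (σ ⟨$⟩ʳ j)

  from : Idx d → Idx d
  from γ i = τ (σ ⟨$⟩ˡ i) ⟨$⟩ˡ γ (σ ⟨$⟩ˡ i)

  from-cong : ∀ {γ δ} → γ ≗ δ → from γ ≗ from δ
  from-cong γ≗δ i = cong (τ (σ ⟨$⟩ˡ i) ⟨$⟩ˡ_) (γ≗δ (σ ⟨$⟩ˡ i))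

  from-at : ∀ γ j → from γ (σ ⟨$⟩ʳ j) ≡ τ j ⟨$⟩ˡ γ j
  from-at γ j with σ ⟨$⟩ˡ (σ ⟨$⟩ʳ j) | inverseˡ σ {j}
  ... | _ | refl = refl

  to-from : ∀ γ → to (from γ) ≗ γ
  to-from γ j = trans (cong (τ j ⟨$⟩ʳ_) (from-at γ j)) (inverseʳ (τ j))

  from-to : ∀ α → from (to α) ≗ α
  from-to α i = trans (inverseˡ (τ (σ ⟨$⟩ˡ i))) (cong α (inverseʳ σ))

  from-updateAt : ∀ γ j h i → i ≢ σ ⟨$⟩ʳ j → from (updateAt γ j h) i ≡ from γ i
  from-updateAt γ j h i i≢σj = cong (τ (σ ⟨$⟩ˡ i) ⟨$⟩ˡ_)
    (updateAt-minimal (σ ⟨$⟩ˡ i) j γ λ σ⁻¹i≡j → i≢σj (trans (sym (inverseʳ σ)) (cong (σ ⟨$⟩ʳ_) σ⁻¹i≡j)))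

  module _ {A : Matrix01 d} (A≡M4 : ∀ α → A α ≡ M4 d (to α)) where

    equivalent-congruent : Congruent A
    equivalent-congruent {α} {α′} α≗α′ =
      trans (A≡M4 α) (trans (M4-cong (λ j → cong (τ j ⟨$⟩ʳ_) (α≗α′ (σ ⟨$⟩ʳ j)))) (sym (A≡M4 α′)))

    sum₄≡0⇒one : ∀ γ → sum₄ γ ≡ 0F → A (from γ) ≡ true
    sum₄≡0⇒one γ Σγ≡0 = trans (A≡M4 (from γ)) (trans (M4-cong (to-from γ)) (sum₄≡0⇒M4 {γ = γ} Σγ≡0))

0<per-of-relabelled-diagonal : ∀ {d} (σ : Permutation′ (suc d)) τ (B : Matrix01 (suc d)) →
  Congruent B → (ρ : Fin (suc d) → Permutation′ 4) →
  (∀ k → B (Relabelling.from σ τ (λ j → ρ j ⟨$⟩ʳ k)) ≡ true) → 0 < per B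
0<per-of-relabelled-diagonal σ τ B B-cong ρ =
  0<per-of-diagonal B B-cong λ i → ρ (σ ⟨$⟩ˡ i) ∘ₚ flip (τ (σ ⟨$⟩ˡ i))

AtMostTwoToOne : (Fin 4 → Bool) → Set
AtMostTwoToOne f = ∀ x y z → f x ≡ f y → f x ≡ f z → x ≡ y ⊎ x ≡ z ⊎ y ≡ z

atMostTwoToOne? : ∀ f → Dec (AtMostTwoToOne f)
atMostTwoToOne? f = all? λ x → all? λ y → all? λ z →
  f x ≟ᴮ f y →-dec f x ≟ᴮ f z →-dec (x ≟ y ⊎-dec x ≟ z ⊎-dec y ≟ z)

p-atMostTwoToOne : ∀ ε → AtMostTwoToOne (p ε)
p-atMostTwoToOne e1 = from-yes (atMostTwoToOne? (p e1))
p-atMostTwoToOne e2 = from-yes (atMostTwoToOne? (p e2))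
p-atMostTwoToOne e3 = from-yes (atMostTwoToOne? (p e3))

atMostTwoToOne-∘ : ∀ {f g} → AtMostTwoToOne f → Injective _≡_ _≡_ g → AtMostTwoToOne (f ∘ g)
atMostTwoToOne-∘ {g = g} f-2:1 g-inj x y z fx≡fy fx≡fz =
  ⊎-map g-inj (⊎-map g-inj g-inj) (f-2:1 (g x) (g y) (g z) fx≡fy fx≡fz)

-- Points are written in the coordinates of 𝓜₄ᵈ, whose coordinate j is coordinate σ j of A.
module BlockParity {d} (E : Fin d → Eps) (σ : Permutation′ d) (τ : Fin d → Permutation′ 4) where
  open Relabelling σ τ

  cubeParity : Idx d → Bool
  cubeParity γ = xorF (pvec E (from γ))

  bit : Fin d → Fin 4 → Bool
  bit j w = p (E (σ ⟨$⟩ʳ j)) (τ j ⟨$⟩ˡ w)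

  bit-atMostTwoToOne : ∀ j → AtMostTwoToOne (bit j)
  bit-atMostTwoToOne j =
    atMostTwoToOne-∘ (p-atMostTwoToOne (E (σ ⟨$⟩ʳ j))) (permutation-injective (flip (τ j)))

  cubeParity-updateAt : ∀ γ j h →
    cubeParity (updateAt γ j h) xor cubeParity γ ≡ bit j (h (γ j)) xor bit j (γ j)
  cubeParity-updateAt γ j h = begin
    cubeParity (updateAt γ j h) xor cubeParity γ
      ≡⟨ xorF-agree-except _ _ (σ ⟨$⟩ʳ j) (λ i i≢σj → cong (p (E i)) (from-updateAt γ j h i i≢σj)) ⟩
    pσj (from (updateAt γ j h) (σ ⟨$⟩ʳ j)) xor pσj (from γ (σ ⟨$⟩ʳ j))
      ≡⟨ cong₂ (λ u v → pσj u xor pσj v)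
               (trans (from-at (updateAt γ j h) j) (cong (τ j ⟨$⟩ˡ_) (updateAt-updates j γ)))
               (from-at γ j) ⟩
    bit j (h (γ j)) xor bit j (γ j) ∎
    where
    open ≡-Reasoning
    pσj = p (E (σ ⟨$⟩ʳ j))

  bit-stable : ∀ {γ j h s} → cubeParity γ ≡ s → cubeParity (updateAt γ j h) ≡ s →
               bit j (h (γ j)) ≡ bit j (γ j)
  bit-stable {γ} {j} {h} {s} γ-filled γ′-filled = xor≡false⇒≡ _ _ (begin
    bit j (h (γ j)) xor bit j (γ j)               ≡⟨ cubeParity-updateAt γ j h ⟨
    cubeParity (updateAt γ j h) xor cubeParity γ  ≡⟨ cong₂ _xor_ γ′-filled γ-filled ⟩
    s xor s                                       ≡⟨ xor-same s ⟩
    false                                         ∎)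
    where open ≡-Reasoning

  cubeParity-stable : ∀ {γ j h} → bit j (h (γ j)) ≡ bit j (γ j) →
                      cubeParity (updateAt γ j h) ≡ cubeParity γ
  cubeParity-stable {γ} {j} {h} same = xor≡false⇒≡ _ _ (begin
    cubeParity (updateAt γ j h) xor cubeParity γ  ≡⟨ cubeParity-updateAt γ j h ⟩
    bit j (h (γ j)) xor bit j (γ j)               ≡⟨ cong (_xor bit j (γ j)) same ⟩
    bit j (γ j) xor bit j (γ j)                   ≡⟨ xor-same (bit j (γ j)) ⟩
    false                                         ∎)
    where open ≡-Reasoning

  sum₄⊕sum₄≡0 : ∀ {s} → (∀ γ → sum₄ γ ≡ 0F → cubeParity γ ≡ s) → ∀ b → cubeParity b ≡ s →
                ∀ {j₀ j₁ j₂} → j₂ ≢ j₁ → j₀ ≢ j₂ → j₀ ≢ j₁ → sum₄ b ⊕ sum₄ b ≡ 0F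
  sum₄⊕sum₄≡0 {s} zeros-filled b b-filled {j₀} {j₁} {j₂} j₂≢j₁ j₀≢j₂ j₀≢j₁ =
    translates-coincide (b j₀) r
      (bit-atMostTwoToOne j₀ (b j₀) (b j₀ ⊕ ⊖ r) (b j₀ ⊕ r) (sym (back j₀)) (sym forth))
    where
    open ≡-Reasoning
    r = sum₄ b
    γ₁ = updateAt b j₁ (_⊕ ⊖ r)
    γ₂ = updateAt γ₁ j₂ (_⊕ ⊖ r)
    γ₃ = updateAt γ₂ j₀ (_⊕ r)

    back-balanced : ∀ j → sum₄ (updateAt b j (_⊕ ⊖ r)) ≡ 0F
    back-balanced j = trans (sum₄-shift b j (⊖ r)) (⊕-inverseʳ r)

    back : ∀ j → bit j (b j ⊕ ⊖ r) ≡ bit j (b j)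
    back j = bit-stable b-filled (zeros-filled _ (back-balanced j))

    γ₂-filled : cubeParity γ₂ ≡ s
    γ₂-filled = trans (cubeParity-stable (subst (λ x → bit j₂ (x ⊕ ⊖ r) ≡ bit j₂ x)
                                            (sym (updateAt-minimal j₂ j₁ b j₂≢j₁)) (back j₂)))
                  (zeros-filled γ₁ (back-balanced j₁))

    γ₃-balanced : sum₄ γ₃ ≡ 0F
    γ₃-balanced = begin
      sum₄ γ₃              ≡⟨ sum₄-shift γ₂ j₀ r ⟩
      sum₄ γ₂ ⊕ r          ≡⟨ cong (_⊕ r) (sum₄-shift γ₁ j₂ (⊖ r)) ⟩
      sum₄ γ₁ ⊕ ⊖ r ⊕ r    ≡⟨ cong (λ t → t ⊕ ⊖ r ⊕ r) (back-balanced j₁) ⟩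
      0F ⊕ ⊖ r ⊕ r         ≡⟨ cong (_⊕ r) (⊕-identityˡ (⊖ r)) ⟩
      ⊖ r ⊕ r              ≡⟨ ⊕-inverseˡ r ⟩
      0F                   ∎

    forth : bit j₀ (b j₀ ⊕ r) ≡ bit j₀ (b j₀)
    forth = subst (λ x → bit j₀ (x ⊕ r) ≡ bit j₀ x)
                  (trans (updateAt-minimal j₀ j₂ γ₁ j₀≢j₂) (updateAt-minimal j₀ j₁ b j₀≢j₁))
                  (bit-stable γ₂-filled (zeros-filled γ₃ γ₃-balanced))

-- Diagonals

alternating : ℕ → Permutation′ 4
alternating zero = id
alternating (suc zero) = negation
alternating (suc (suc n)) = alternating n

alternating-0 : ∀ n → alternating n ⟨$⟩ʳ 0F ≡ 0F
alternating-0 zero = refl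
alternating-0 (suc zero) = refl
alternating-0 (suc (suc n)) = alternating-0 n

sum₄-alternating : ∀ n → parity n ≡ 0ℙ → ∀ k → sum₄ {n} (λ j → alternating (toℕ j) ⟨$⟩ʳ k) ≡ 0F
sum₄-alternating zero _ k = refl
sum₄-alternating (suc (suc n)) even k = begin
  k ⊕ (⊖ k ⊕ sum₄ {n} (λ j → alternating (toℕ j) ⟨$⟩ʳ k))
    ≡⟨ cong (λ t → k ⊕ (⊖ k ⊕ t)) (sum₄-alternating n even k) ⟩
  k ⊕ (⊖ k ⊕ 0F)  ≡⟨ cong (k ⊕_) (⊕-identityʳ (⊖ k)) ⟩
  k ⊕ ⊖ k         ≡⟨ ⊕-inverseʳ k ⟩
  0F              ∎
  where open ≡-Reasoning

rotating : ℕ → Permutation′ 4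
rotating zero = id
rotating (suc zero) = rotation
rotating (suc (suc zero)) = rotation ∘ₚ rotation
rotating (suc (suc (suc n))) = alternating n

rotating-0 : ∀ n → rotating n ⟨$⟩ʳ 0F ≡ 0F
rotating-0 zero = refl
rotating-0 (suc zero) = refl
rotating-0 (suc (suc zero)) = refl
rotating-0 (suc (suc (suc n))) = alternating-0 n

sum₄-rotating : ∀ n → parity n ≡ 0ℙ → ∀ k → k ≢ 0F →
                sum₄ {3 + n} (λ j → rotating (toℕ j) ⟨$⟩ʳ k) ≡ 2F
sum₄-rotating n even k k≢0 = begin
  k ⊕ (rotate k ⊕ (rotate (rotate k) ⊕ sum₄ {n} (λ j → alternating (toℕ j) ⟨$⟩ʳ k)))
    ≡⟨ cong (λ t → k ⊕ (rotate k ⊕ (rotate (rotate k) ⊕ t))) (sum₄-alternating n even k) ⟩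
  k ⊕ (rotate k ⊕ (rotate (rotate k) ⊕ 0F))
    ≡⟨ cong (λ t → k ⊕ (rotate k ⊕ t)) (⊕-identityʳ (rotate (rotate k))) ⟩
  k ⊕ (rotate k ⊕ rotate (rotate k))
    ≡⟨ rotate-orbit-sum k k≢0 ⟩
  2F ∎
  where open ≡-Reasoning

even-or-odd : ∀ n → parity n ≡ 0ℙ ⊎ parity (suc n) ≡ 0ℙ
even-or-odd zero = inj₁ refl
even-or-odd (suc zero) = inj₂ refl
even-or-odd (suc (suc n)) = even-or-odd n

0<per-of-even-dimension : ∀ {d} → parity (suc d) ≡ 0ℙ → ∀ {A : Matrix01 (suc d)} σ τ →
  (∀ α → A α ≡ M4 (suc d) (Relabelling.to σ τ α)) →
  ∀ B → Congruent B → (∀ α → A α ≡ true → B α ≡ true) → 0 < per B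
0<per-of-even-dimension {d} even σ τ A≡M4 B B-cong A⊆B =
  0<per-of-relabelled-diagonal σ τ B B-cong (alternating ∘ toℕ) λ k →
    A⊆B _ (Relabelling.sum₄≡0⇒one σ τ A≡M4 (λ j → alternating (toℕ j) ⟨$⟩ʳ k)
                                           (sum₄-alternating (suc d) even k))

0<per-setOne-of-odd-dimension : ∀ n → parity n ≡ 0ℙ → ∀ {A : Matrix01 (3 + n)} σ τ →
  (∀ α → A α ≡ M4 (3 + n) (Relabelling.to σ τ α)) →
  ∀ β → sum₄ (Relabelling.to σ τ β) ≡ 2F → 0 < per (setOne A β)
0<per-setOne-of-odd-dimension n even {A} σ τ A≡M4 β Σb≡2 =
  0<per-of-relabelled-diagonal σ τ (setOne A β) (setOne-congruent (equivalent-congruent A≡M4) β) ρ rows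
  where
  open Relabelling σ τ
  open ≡-Reasoning
  b = to β
  ρ : Fin (3 + n) → Permutation′ 4
  ρ j = rotating (toℕ j) ∘ₚ translation (b j)
  shape : Fin 4 → Fin (3 + n) → Fin 4
  shape k j = rotating (toℕ j) ⟨$⟩ʳ k
  row₀≗b : (λ j → ρ j ⟨$⟩ʳ 0F) ≗ b
  row₀≗b j = trans (cong (_⊕ b j) (rotating-0 (toℕ j))) (⊕-identityˡ (b j))
  rows : ∀ k → setOne A β (from (λ j → ρ j ⟨$⟩ʳ k)) ≡ true
  rows k with k ≟ 0F
  ... | yes refl = setOne-at A β λ i → trans (from-cong row₀≗b i) (from-to β i)
  ... | no k≢0 = setOne-≥ A β (sum₄≡0⇒one A≡M4 (λ j → ρ j ⟨$⟩ʳ k) (begin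
    sum₄ (λ j → shape k j ⊕ b j)  ≡⟨ sum₄-⊕ (shape k) b ⟩
    sum₄ (shape k) ⊕ sum₄ b       ≡⟨ cong₂ _⊕_ (sum₄-rotating n even k k≢0) Σb≡2 ⟩
    2F ⊕ 2F                       ≡⟨⟩
    0F                            ∎))

sum₄-changed-entry≡2 : ∀ {d} {A : Matrix01 d} {E lam s} → IsBlockPerm A E lam s → ∀ σ τ →
  (∀ α → A α ≡ M4 d (Relabelling.to σ τ α)) →
  ∀ {y} → Filled s y → ∀ {β} → InSubcube E y β → A β ≡ false →
  ∀ {j₀ j₁ j₂} → j₂ ≢ j₁ → j₀ ≢ j₂ → j₀ ≢ j₁ → sum₄ (Relabelling.to σ τ β) ≡ 2F
sum₄-changed-entry≡2 {E = E} {lam} {s} isB σ τ A≡M4 y-filled {β} β∈C Aβ≡0 j₂≢j₁ j₀≢j₂ j₀≢j₁ =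
  r⊕r≡0⇒r≡2 (sum₄ b) Σb≢0 (sum₄⊕sum₄≡0 zeros-filled b b-filled j₂≢j₁ j₀≢j₂ j₀≢j₁)
  where
  open Relabelling σ τ
  open BlockParity E σ τ
  b = to β
  zeros-filled : ∀ γ → sum₄ γ ≡ 0F → cubeParity γ ≡ s
  zeros-filled γ Σγ≡0 = ones-in-filled-subcubes {E = E} {lam} isB (from γ) (sum₄≡0⇒one A≡M4 γ Σγ≡0)
  b-filled : cubeParity b ≡ s
  b-filled = trans (xorF-cong λ i → trans (cong (p (E i)) (from-to β i)) (β∈C i)) y-filled
  Σb≢0 : sum₄ b ≢ 0F
  Σb≢0 Σb≡0 = contradiction (trans (sym Aβ≡0) (trans (A≡M4 β) (sum₄≡0⇒M4 {γ = b} Σb≡0))) λ ()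

lemma6 : (d : ℕ) → 2 ≤ d →
    (A : Matrix01 d) (E : Fin d → Eps) (lam : (Fin d → Bool) → Bool) (s : Bool) →
    IsBlockPerm A E lam s →
    Equivalent A (M4 d) →
    (y : Fin d → Bool) → Filled s y →
    (β : Idx d) → InSubcube E y β → A β ≡ false →
    0 < per (setOne A β)
lemma6 (suc zero) (s≤s ())
lemma6 (suc (suc zero)) _ A E lam s isB (σ , τ , A≡M4) y y-filled β β∈C Aβ≡0 =
  0<per-of-even-dimension refl σ τ A≡M4 (setOne A β)
    (setOne-congruent (Relabelling.equivalent-congruent σ τ A≡M4) β) (λ _ → setOne-≥ A β)
lemma6 (suc (suc (suc n))) _ A E lam s isB (σ , τ , A≡M4) y y-filled β β∈C Aβ≡0 =
  [ (λ n-even → 0<per-setOne-of-odd-dimension n n-even σ τ A≡M4 β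
       (sum₄-changed-entry≡2 {E = E} {lam} isB σ τ A≡M4 y-filled β∈C Aβ≡0 {0F} {1F} {2F}
                             (λ ()) (λ ()) (λ ())))
  , (λ d-even → 0<per-of-even-dimension d-even σ τ A≡M4 (setOne A β)
       (setOne-congruent (Relabelling.equivalent-congruent σ τ A≡M4) β) (λ _ → setOne-≥ A β))
  ]′ (even-or-odd n)
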